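{- If $H$ and $G$ are graphs such that $H$ is an immersion of $G$, then $\delta_{\rm e}^{\infty}(H)\leq\delta_{\rm e}^{\infty}(G)$.
   Context: Graphs are finite, undirected, loopless, possibly with parallel edges. Lifting two edges $ua,ub$ ($a\neq b$) means replacing them by an edge $ab$; $H$ is an immersion of $G$ if a graph isomorphic to $H$ can be obtained from a subgraph of $G$ by a sequence of liftings. For $x\in V(G)$ and $S\subseteq V(G)\setminus\{x\}$, ${\bf supp}_G(x,S)$ is the minimum size of a set $A\subseteq E(G)$ (with multiplicity) such that every path from $x$ to a vertex of $S$ contains an edge of $A$ ($0$ if $S=\emptyset$). For a layout $L=\langle v_1,\dots,v_n\rangle$ of $V(G)$ its value is $\max_i{\bf supp}_G(v_i,\{v_1,\dots,v_{i-1}\})$, and $\delta_{\rm e}^{\infty}(G)$ is the minimum value over all layouts. -}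

module Defs where

open import Data.Nat using (ℕ; _≤_; _<_)
open import Data.Fin using (Fin; toℕ)
open import Data.Product using (Σ; ∃; _×_; _,_; proj₁; proj₂)
open import Data.Sum using (_⊎_)
open import Data.List using (List; []; _∷_; _++_; map; length)
open import Data.List.Relation.Unary.All using (All)
open import Data.List.Relation.Binary.Pointwise using (Pointwise)
open import Data.List.Relation.Binary.Permutation.Propositional using (_↭_)
open import Data.List.Membership.Propositional using (_∈_)
open import Relation.Binary.PropositionalEquality using (_≡_; _≢_)
open import Relation.Binary.Construct.Closure.ReflexiveTransitive using (Star)
open import Relation.Nullary using (¬_)
open import Function.Bundles using (_↔_; _↣_; Inverse; Injection)

-- Finite loopless multigraphs.  Vertices are Fin n; edges form a list
-- (multiset) of vertex pairs, each pair read as an UNORDERED edge;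
-- parallel edges are repeated list entries.

Edge : ℕ → Set
Edge n = Fin n × Fin n

record Graph : Set where
  field
    n        : ℕ
    E        : List (Edge n)
    loopless : All (λ e → proj₁ e ≢ proj₂ e) E
open Graph public

SameEnds : ∀ {n} → Edge n → Edge n → Set
SameEnds (a , b) (c , d) = (a ≡ c × b ≡ d) ⊎ (a ≡ d × b ≡ c)

EqE : ∀ {n} → List (Edge n) → List (Edge n) → Set
EqE L₁ L₂ = ∃ λ L → Pointwise SameEnds L₁ L × L ↭ L₂

mapEdge : ∀ {n m} → (Fin n → Fin m) → Edge n → Edge m
mapEdge f (a , b) = f a , f b

-- Subgraph: S is (an isomorphic copy of) a subgraph of G, given by an
-- injective vertex map ι with the image of E(S) a sub-multiset of E(G).

Subgraph : Graph → Graph → Set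
Subgraph S G =
  Σ (Fin (n S) ↣ Fin (n G)) λ ι →
    ∃ λ rest → EqE (map (mapEdge (Injection.to ι)) (E S) ++ rest) (E G)

LiftE : ∀ {n} → List (Edge n) → List (Edge n) → Set
LiftE {n} L L′ =
  Σ (Fin n) λ u → Σ (Fin n) λ a → Σ (Fin n) λ b →
  Σ (Edge n) λ e₁ → Σ (Edge n) λ e₂ → Σ (List (Edge n)) λ rest →
    a ≢ b × SameEnds e₁ (u , a) × SameEnds e₂ (u , b) ×
    L ↭ (e₁ ∷ e₂ ∷ rest) × L′ ↭ ((a , b) ∷ rest)

Iso : ∀ {n m} → List (Edge n) → List (Edge m) → Set
Iso {n} {m} L L′ =
  Σ (Fin n ↔ Fin m) λ σ → EqE (map (mapEdge (Inverse.to σ)) L) L′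

Immersion : Graph → Graph → Set
Immersion H G =
  Σ Graph λ S → Subgraph S G ×
    (∃ λ (L : List (Edge (n S))) → Star LiftE (E S) L × Iso L (E H))

Adj : ∀ {n} → List (Edge n) → Fin n → Fin n → Set
Adj R a b = ((a , b) ∈ R) ⊎ ((b , a) ∈ R)

data Reach {n} (R : List (Edge n)) : Fin n → Fin n → Set where
  here : ∀ {x} → Reach R x x
  step : ∀ {x y z} → Adj R x y → Reach R y z → Reach R x z

-- A ⊆ E(G) (as a sub-multiset, E(G) = A ⊎ R) meets every path from x
-- to a vertex of S  (S given as a predicate on vertices)
Separates : (G : Graph) → Fin (n G) → (Fin (n G) → Set) →
            List (Edge (n G)) → List (Edge (n G)) → Set
Separates G x S A R = (E G ↭ A ++ R) × (∀ y → S y → ¬ Reach R x y)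

Supp : (G : Graph) → Fin (n G) → (Fin (n G) → Set) → ℕ → Set
Supp G x S s =
  (∃ λ A → ∃ λ R → Separates G x S A R × length A ≡ s) ×
  (∀ A R → Separates G x S A R → s ≤ length A)

-- a layout ⟨v_1,…,v_n⟩: position ↦ vertex, a bijection
Layout : Graph → Set
Layout G = Fin (n G) ↔ Fin (n G)

Before : (G : Graph) → Layout G → Fin (n G) → Fin (n G) → Set
Before G L i y = ∃ λ j → toℕ j < toℕ i × Inverse.to L j ≡ y

ValueAtMost : (G : Graph) → Layout G → ℕ → Set
ValueAtMost G L k =
  ∀ i s → Supp G (Inverse.to L i) (Before G L i) s → s ≤ k

IsDeltaEInf : Graph → ℕ → Set
IsDeltaEInf G d =
  (Σ (Layout G) λ L → ValueAtMost G L d) ×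
  (∀ k → (Σ (Layout G) λ L → ValueAtMost G L k) → d ≤ k)

module Submission where

-- Encode an edge cut by a 2-colouring X of the vertices: the edges crossing X, with X x = true and
-- X false on S, separate x from S, and conversely the vertices reachable from x without using a
-- separator A colour the graph so that at most |A| edges cross.  Hence supp(x,S) is the least number
-- of crossing edges of such a colouring.  Crossing edges can only get fewer when passing to a
-- subgraph or lifting ua, ub to ab (if ab crosses, so does one of ua, ub), so pulling a colouring of
-- G back along the vertex embedding of an immersion H of G does not increase its cut.  Ordering V(H)
-- by the positions of their images in a layout of G, the vertices before v in H map to vertices
-- before the image of v in G, and every supp in H is bounded by the corresponding supp in G.

open import Defs
open import Data.Nat using (ℕ; zero; suc; _+_; _≤_; _<_; z≤n; s≤s)
open import Data.Nat.Properties
  using (≤-refl; ≤-trans; <⇒≤; ≰⇒>; ≮⇒≥; ≤∧≢⇒<; <-irrefl; +-monoˡ-≤; +-assoc; +-identityʳ;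
         m≤m+n; _≤?_; module ≤-Reasoning)
open import Data.Nat.Induction using (<-rec)
open import Data.Nat.ListAction using (sum)
open import Data.Nat.ListAction.Properties using (sum-++; sum-↭)
open import Data.Bool using (Bool; true; false; not; _xor_; if_then_else_; T?)
open import Data.Bool.Properties using (xor-comm; not-injective; not-¬; T-not-≡)
open import Data.Fin using (Fin; toℕ; punchIn)
open import Data.Fin.Properties using (toℕ-injective; punchIn-injective; punchInᵢ≢i)
import Data.Fin.Permutation as Permutation
open import Data.Product using (Σ; ∃; _×_; _,_; proj₁; proj₂)
open import Data.Sum using (inj₁; inj₂)
open import Data.List using (List; []; _∷_; _++_; map; length; filterᵇ)
open import Data.List.Properties using (map-++; map-∘; map-cong; length-filter; ++-identityʳ)
open import Data.List.Relation.Binary.Pointwise as Pointwise using (Pointwise; Pointwise-≡⇒≡; _∷_)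
open import Data.List.Relation.Binary.Permutation.Propositional
  using (_↭_; prep; ↭-refl; ↭-sym; ↭-trans; ↭-reflexive)
open import Data.List.Relation.Binary.Permutation.Propositional.Properties as ↭ using (shift)
open import Data.List.Relation.Unary.Any using (here; there)
open import Data.List.Membership.Propositional using (_∈_)
open import Data.List.Membership.Propositional.Properties using (∈-filter⁻)
open import Relation.Binary.PropositionalEquality
  using (_≡_; refl; sym; trans; cong; cong₂; subst; module ≡-Reasoning)
open import Relation.Binary.Construct.Closure.ReflexiveTransitive using (Star; ε; _◅_)
open import Relation.Nullary using (¬_; yes; no; does; contradiction)
open import Relation.Nullary.Decidable using (decidable-stable; dec-true; dec-false; ¬¬-excluded-middle)
open import Relation.Nullary.Negation using (¬¬-Monad)
open import Relation.Unary using (Decidable)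
open import Effect.Monad using (RawMonad)
open import Level using (0ℓ)
open import Function using (_∘_)
open import Function.Bundles using (_↔_; _↣_; Inverse; Injection; Equivalence)
open import Function.Definitions using (Injective)
open import Function.Properties.Inverse using (↔-sym; ↔⇒↣)
open import Function.Construct.Composition using (_↣-∘_)

open RawMonad (¬¬-Monad {a = 0ℓ})

private
  variable
    m : ℕ

crosses : (Fin m → Bool) → Edge m → Bool
crosses X (a , b) = X a xor X b

crossing : (Fin m → Bool) → Edge m → ℕ
crossing X e = if crosses X e then 1 else 0

cut : (Fin m → Bool) → List (Edge m) → ℕ
cut X E = sum (map (crossing X) E)

crossing-sameEnds : (X : Fin m → Bool) {e f : Edge m} → SameEnds e f → crossing X e ≡ crossing X f
crossing-sameEnds X         (inj₁ (refl , refl)) = refl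
crossing-sameEnds X {a , b} (inj₂ (refl , refl)) = cong (if_then 1 else 0) (xor-comm (X a) (X b))

crossing-triangle : (X : Fin m → Bool) (u a b : Fin m) →
                    crossing X (a , b) ≤ crossing X (u , a) + crossing X (u , b)
crossing-triangle X u a b with X u | X a | X b
... | _     | false | false = z≤n
... | _     | true  | true  = z≤n
... | false | false | true  = ≤-refl
... | false | true  | false = s≤s z≤n
... | true  | false | true  = s≤s z≤n
... | true  | true  | false = ≤-refl

cut-++ : (X : Fin m → Bool) (A B : List (Edge m)) → cut X (A ++ B) ≡ cut X A + cut X B
cut-++ X A B = trans (cong sum (map-++ (crossing X) A B)) (sum-++ (map (crossing X) A) _)

cut-↭ : (X : Fin m → Bool) {A B : List (Edge m)} → A ↭ B → cut X A ≡ cut X B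
cut-↭ X A↭B = sum-↭ (↭.map⁺ (crossing X) A↭B)

cut-pointwise : (X : Fin m → Bool) {A B : List (Edge m)} → Pointwise SameEnds A B → cut X A ≡ cut X B
cut-pointwise X A≈B =
  cong sum (Pointwise-≡⇒≡ (Pointwise.map⁺ _ _ (Pointwise.map (crossing-sameEnds X) A≈B)))

cut-EqE : (X : Fin m → Bool) {A B : List (Edge m)} → EqE A B → cut X A ≡ cut X B
cut-EqE X (_ , A≈C , C↭B) = trans (cut-pointwise X A≈C) (cut-↭ X C↭B)

cut-map : ∀ {k} (X : Fin m → Bool) (f : Fin k → Fin m) (E : List (Edge k)) →
          cut X (map (mapEdge f) E) ≡ cut (X ∘ f) E
cut-map X f E = cong sum (sym (map-∘ E))

cut-cong : {X Y : Fin m → Bool} → (∀ v → X v ≡ Y v) → (E : List (Edge m)) → cut X E ≡ cut Y E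
cut-cong X≗Y = cong sum ∘ map-cong λ (a , b) →
  cong₂ (λ p q → if p xor q then 1 else 0) (X≗Y a) (X≗Y b)

cut-lift : (X : Fin m → Bool) {L L′ : List (Edge m)} → LiftE L L′ → cut X L′ ≤ cut X L
cut-lift X {L} {L′} (u , a , b , e₁ , e₂ , rest , _ , e₁≈ua , e₂≈ub , L↭ , L′↭) = begin
  cut X L′                                              ≡⟨ cut-↭ X L′↭ ⟩
  crossing X (a , b) + cut X rest                       ≤⟨ +-monoˡ-≤ _ (crossing-triangle X u a b) ⟩
  crossing X (u , a) + crossing X (u , b) + cut X rest  ≡⟨ +-assoc (crossing X (u , a)) _ (cut X rest) ⟩
  cut X ((u , a) ∷ (u , b) ∷ rest)                      ≡⟨ cut-pointwise X e₁e₂rest≈uaubrest ⟨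
  cut X (e₁ ∷ e₂ ∷ rest)                                ≡⟨ cut-↭ X L↭ ⟨
  cut X L                                               ∎
  where
  open ≤-Reasoning
  e₁e₂rest≈uaubrest : Pointwise SameEnds (e₁ ∷ e₂ ∷ rest) ((u , a) ∷ (u , b) ∷ rest)
  e₁e₂rest≈uaubrest = e₁≈ua ∷ e₂≈ub ∷ Pointwise.refl (inj₁ (refl , refl))

cut-lifts : (X : Fin m → Bool) {L L′ : List (Edge m)} → Star LiftE L L′ → cut X L′ ≤ cut X L
cut-lifts X ε        = ≤-refl
cut-lifts X (l ◅ ls) = ≤-trans (cut-lifts X ls) (cut-lift X l)

cut-subgraph : (S G : Graph) ((ι , _) : Subgraph S G) (X : Fin (n G) → Bool) →
               cut (X ∘ Injection.to ι) (E S) ≤ cut X (E G)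
cut-subgraph S G (ι , rest , ιS++rest≈G) X = begin
  cut (X ∘ Injection.to ι) (E S)  ≡⟨ cut-map X (Injection.to ι) (E S) ⟨
  cut X ιS                        ≤⟨ m≤m+n (cut X ιS) (cut X rest) ⟩
  cut X ιS + cut X rest           ≡⟨ cut-++ X ιS rest ⟨
  cut X (ιS ++ rest)              ≡⟨ cut-EqE X ιS++rest≈G ⟩
  cut X (E G)                     ∎
  where
  open ≤-Reasoning
  ιS : List (Edge (n G))
  ιS = map (mapEdge (Injection.to ι)) (E S)

cut-iso : ∀ {m k} {L : List (Edge m)} {L′ : List (Edge k)} ((σ , _) : Iso L L′) (Y : Fin m → Bool) →
          cut (Y ∘ Inverse.from σ) L′ ≡ cut Y L
cut-iso {m} {k} {L} {L′} (σ , σL≈L′) Y = begin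
  cut (Y ∘ σ⁻¹) L′                      ≡⟨ cut-EqE (Y ∘ σ⁻¹) σL≈L′ ⟨
  cut (Y ∘ σ⁻¹) (map (mapEdge σ→) L)    ≡⟨ cut-map (Y ∘ σ⁻¹) σ→ L ⟩
  cut (Y ∘ σ⁻¹ ∘ σ→) L                  ≡⟨ cut-cong (cong Y ∘ Inverse.strictlyInverseʳ σ) L ⟩
  cut Y L                               ∎
  where
  open ≡-Reasoning
  σ→ : Fin m → Fin k
  σ→ = Inverse.to σ
  σ⁻¹ : Fin k → Fin m
  σ⁻¹ = Inverse.from σ

immersionEmbedding : (H G : Graph) → Immersion H G → Fin (n H) ↣ Fin (n G)
immersionEmbedding H G (_ , (ι , _) , _ , _ , (σ , _)) = ι ↣-∘ ↔⇒↣ (↔-sym σ)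

cut-immersion : (H G : Graph) (im : Immersion H G) (X : Fin (n G) → Bool) →
                cut (X ∘ Injection.to (immersionEmbedding H G im)) (E H) ≤ cut X (E G)
cut-immersion H G im@(S , sub@(ι , _) , L , lifts , iso) X = begin
  cut (X ∘ Injection.to (immersionEmbedding H G im)) (E H)  ≡⟨ cut-iso iso (X ∘ Injection.to ι) ⟩
  cut (X ∘ Injection.to ι) L                                ≤⟨ cut-lifts (X ∘ Injection.to ι) lifts ⟩
  cut (X ∘ Injection.to ι) (E S)                            ≤⟨ cut-subgraph S G sub X ⟩
  cut X (E G)                                               ∎
  where open ≤-Reasoning

-- supp as a minimum cut

Uncut : (Fin m → Bool) → List (Edge m) → Set
Uncut X R = ∀ {e} → e ∈ R → crosses X e ≡ false

Splits : (Fin m → Bool) → Fin m → (Fin m → Set) → Set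
Splits X x S = X x ≡ true × (∀ y → S y → X y ≡ false)

crossingEdges uncutEdges : (Fin m → Bool) → List (Edge m) → List (Edge m)
crossingEdges X = filterᵇ (crosses X)
uncutEdges    X = filterᵇ (not ∘ crosses X)

crossingEdges-uncutEdges-↭ : (X : Fin m → Bool) (E : List (Edge m)) →
                             E ↭ crossingEdges X E ++ uncutEdges X E
crossingEdges-uncutEdges-↭ X []      = ↭-refl
crossingEdges-uncutEdges-↭ X (e ∷ E) with crosses X e
... | true  = prep e (crossingEdges-uncutEdges-↭ X E)
... | false = ↭-trans (prep e (crossingEdges-uncutEdges-↭ X E))
                      (↭-sym (shift e (crossingEdges X E) (uncutEdges X E)))

length-crossingEdges : (X : Fin m → Bool) (E : List (Edge m)) → length (crossingEdges X E) ≡ cut X E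
length-crossingEdges X []      = refl
length-crossingEdges X (e ∷ E) with crosses X e
... | true  = cong suc (length-crossingEdges X E)
... | false = length-crossingEdges X E

uncutEdges-uncut : (X : Fin m → Bool) (E : List (Edge m)) → Uncut X (uncutEdges X E)
uncutEdges-uncut X E e∈ =
  Equivalence.to T-not-≡ (proj₂ (∈-filter⁻ (T? ∘ not ∘ crosses X) {xs = E} e∈))

cut-uncut : (X : Fin m → Bool) {R : List (Edge m)} → Uncut X R → cut X R ≡ 0
cut-uncut X {[]}    uncut = refl
cut-uncut X {e ∷ R} uncut rewrite uncut (here refl) = cut-uncut X (uncut ∘ there)

cut≤length : (X : Fin m → Bool) (A : List (Edge m)) → cut X A ≤ length A
cut≤length X A = subst (_≤ length A) (length-crossingEdges X A) (length-filter (T? ∘ crosses X) A)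

cut≤length-of-complement : (X : Fin m → Bool) {E A R : List (Edge m)} →
                           E ↭ A ++ R → Uncut X R → cut X E ≤ length A
cut≤length-of-complement X {E} {A} {R} E↭A++R uncut = begin
  cut X E            ≡⟨ trans (cut-↭ X E↭A++R) (cut-++ X A R) ⟩
  cut X A + cut X R  ≡⟨ cong (cut X A +_) (cut-uncut X uncut) ⟩
  cut X A + 0        ≡⟨ +-identityʳ (cut X A) ⟩
  cut X A            ≤⟨ cut≤length X A ⟩
  length A           ∎
  where open ≤-Reasoning

xor≡false⇒≡ : ∀ p q → p xor q ≡ false → p ≡ q
xor≡false⇒≡ false q p⊕q≡false = sym p⊕q≡false
xor≡false⇒≡ true  q p⊕q≡false = sym (not-injective p⊕q≡false)

reach-uncut : (X : Fin m → Bool) {R : List (Edge m)} → Uncut X R → ∀ {x y} → Reach R x y → X x ≡ X y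
reach-uncut X uncut here = refl
reach-uncut X uncut (step {x} {y} (inj₁ xy∈R) y⇝) =
  trans (xor≡false⇒≡ (X x) (X y) (uncut xy∈R)) (reach-uncut X uncut y⇝)
reach-uncut X uncut (step {x} {y} (inj₂ yx∈R) y⇝) =
  trans (sym (xor≡false⇒≡ (X y) (X x) (uncut yx∈R))) (reach-uncut X uncut y⇝)

reach-snoc : {R : List (Edge m)} {x a b : Fin m} → Reach R x a → Adj R a b → Reach R x b
reach-snoc here         a~b = step a~b here
reach-snoc (step x~ a⇝) a~b = step x~ (reach-snoc a⇝ a~b)

reach-[] : {x y : Fin m} → Reach [] x y → x ≡ y
reach-[] here = refl
reach-[] (step (inj₁ ()) _)
reach-[] (step (inj₂ ()) _)

module _ {R : List (Edge m)} {x : Fin m} (reach? : Decidable (Reach R x)) where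

  reachable : Fin m → Bool
  reachable = does ∘ reach?

  reachable-uncut : Uncut reachable R
  reachable-uncut {a , b} ab∈R with reach? a | reach? b
  ... | yes _   | yes _   = refl
  ... | no  _   | no  _   = refl
  ... | yes x⇝a | no  x↛b = contradiction (reach-snoc x⇝a (inj₁ ab∈R)) x↛b
  ... | no  x↛a | yes x⇝b = contradiction (reach-snoc x⇝b (inj₂ ab∈R)) x↛a

  reachable-splits : {S : Fin m → Set} → (∀ y → S y → ¬ Reach R x y) → Splits reachable x S
  reachable-splits S-unreachable =
    dec-true (reach? x) here , λ y Sy → dec-false (reach? y) (S-unreachable y Sy)

¬¬-decidable : ∀ {k} (P : Fin k → Set) → ¬ ¬ Decidable P
¬¬-decidable {zero}  P = pure λ ()
¬¬-decidable {suc k} P = do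
  P₀? ← ¬¬-excluded-middle
  Pₛ? ← ¬¬-decidable (P ∘ Fin.suc)
  pure λ { Fin.zero → P₀? ; (Fin.suc i) → Pₛ? i }

-- No decidability is needed: if P had no least element, strong induction would show P empty.
¬¬-minimum : (P : ℕ → Set) {k : ℕ} → P k → ¬ ¬ (∃ λ s → P s × (∀ t → P t → s ≤ t))
¬¬-minimum P {k} Pk no-minimum = <-rec (λ t → ¬ P t) no-smaller⇒¬P k Pk
  where
  no-smaller⇒¬P : ∀ t → (∀ {u} → u < t → ¬ P u) → ¬ P t
  no-smaller⇒¬P t smaller-fail Pt = no-minimum (t , Pt , λ u Pu → ≮⇒≥ (λ u<t → smaller-fail u<t Pu))

splitting⇒separator : (G : Graph) {X : Fin (n G) → Bool} {x : Fin (n G)} {S : Fin (n G) → Set} →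
                      Splits X x S → Separates G x S (crossingEdges X (E G)) (uncutEdges X (E G))
splitting⇒separator G {X} (Xx≡true , XS≡false) =
  crossingEdges-uncutEdges-↭ X (E G) ,
  λ y Sy x⇝y → not-¬ (XS≡false y Sy) (trans (sym (reach-uncut X uncut x⇝y)) Xx≡true)
  where
  uncut : Uncut X (uncutEdges X (E G))
  uncut = uncutEdges-uncut X (E G)

separator⇒¬¬splitting : (G : Graph) {x : Fin (n G)} {S : Fin (n G) → Set} {A R : List (Edge (n G))} →
                        Separates G x S A R → ¬ ¬ (∃ λ X → Splits X x S × cut X (E G) ≤ length A)
separator⇒¬¬splitting G {x} {R = R} (E↭A++R , S-unreachable) = do
  reach? ← ¬¬-decidable (Reach R x)
  pure (reachable reach? , reachable-splits reach? S-unreachable ,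
        cut≤length-of-complement (reachable reach?) E↭A++R (reachable-uncut reach?))

supp≤cut : (G : Graph) {x : Fin (n G)} {S : Fin (n G) → Set} {s : ℕ} {X : Fin (n G) → Bool} →
           Supp G x S s → Splits X x S → s ≤ cut X (E G)
supp≤cut G {s = s} {X} (_ , minimal) splits =
  subst (s ≤_) (length-crossingEdges X (E G)) (minimal _ _ (splitting⇒separator G splits))

¬¬-cut≤supp : (G : Graph) {x : Fin (n G)} {S : Fin (n G) → Set} {s : ℕ} →
              Supp G x S s → ¬ ¬ (∃ λ X → Splits X x S × cut X (E G) ≤ s)
¬¬-cut≤supp G ((_ , _ , separates , refl) , _) = separator⇒¬¬splitting G separates

¬¬-∃supp : (G : Graph) {x : Fin (n G)} {S : Fin (n G) → Set} → ¬ S x → ¬ ¬ ∃ (Supp G x S)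
¬¬-∃supp G {x} {S} ¬Sx = do
  (s , separator , minimal) ← ¬¬-minimum SeparatorOfSize allEdges
  pure (s , separator , λ A R separates → minimal (length A) (A , R , separates , refl))
  where
  SeparatorOfSize : ℕ → Set
  SeparatorOfSize t = ∃ λ A → ∃ λ R → Separates G x S A R × length A ≡ t
  allEdges : SeparatorOfSize (length (E G))
  allEdges = E G , [] , (↭-reflexive (sym (++-identityʳ (E G))) , S-unreachable) , refl
    where
    S-unreachable : ∀ y → S y → ¬ Reach [] x y
    S-unreachable y Sy x⇝y = ¬Sx (subst S (sym (reach-[] x⇝y)) Sy)

argmin : ∀ {k} (g : Fin (suc k) → ℕ) → ∃ λ i → ∀ j → g i ≤ g j
argmin {zero}  g = Fin.zero , λ { Fin.zero → ≤-refl }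
argmin {suc k} g with argmin (g ∘ Fin.suc)
... | i , gᵢ≤ with g Fin.zero ≤? g (Fin.suc i)
...   | yes g₀≤gᵢ = Fin.zero  , λ { Fin.zero → ≤-refl ; (Fin.suc j) → ≤-trans g₀≤gᵢ (gᵢ≤ j) }
...   | no  g₀≰gᵢ = Fin.suc i , λ { Fin.zero → <⇒≤ (≰⇒> g₀≰gᵢ) ; (Fin.suc j) → gᵢ≤ j }

SortedBy : ∀ {k} → (Fin k → ℕ) → Fin k ↔ Fin k → Set
SortedBy g π = ∀ j i → toℕ j < toℕ i → g (Inverse.to π j) < g (Inverse.to π i)

sortingPermutation : ∀ {k} (g : Fin k → ℕ) → Injective _≡_ _≡_ g → Σ (Fin k ↔ Fin k) (SortedBy g)
sortingPermutation {zero}  g g-injective = Permutation.id , λ ()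
sortingPermutation {suc k} g g-injective
  with i₀ , gᵢ₀≤ ← argmin g
  with π , π-sorted ← sortingPermutation (g ∘ punchIn i₀) (punchIn-injective i₀ _ _ ∘ g-injective)
  = π′ , sorted
  where
  π′ : Fin (suc k) ↔ Fin (suc k)
  π′ = Permutation.insert Fin.zero i₀ π
  to-suc : ∀ j → Inverse.to π′ (Fin.suc j) ≡ punchIn i₀ (Inverse.to π j)
  to-suc = Permutation.insert-punchIn Fin.zero i₀ π
  sorted : SortedBy g π′
  sorted Fin.zero    (Fin.suc i) _ rewrite to-suc i =
    ≤∧≢⇒< (gᵢ₀≤ _) (λ gᵢ₀≡ → punchInᵢ≢i i₀ (Inverse.to π i) (sym (g-injective gᵢ₀≡)))
  sorted (Fin.suc j) (Fin.suc i) (s≤s j<i) rewrite to-suc i | to-suc j = π-sorted j i j<i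

inducedLayout : {H G : Graph} (f : Fin (n H) ↣ Fin (n G)) (L : Layout G) →
                Σ (Layout H) λ L′ → ∀ i y → Before H L′ i y →
                  Before G L (Inverse.from L (Injection.to f (Inverse.to L′ i))) (Injection.to f y)
inducedLayout {H} {G} f L =
  proj₁ sorting ,
  λ { i y (j , j<i , refl) →
        Inverse.from L (Injection.to f y) , proj₂ sorting j i j<i , Inverse.strictlyInverseˡ L _ }
  where
  position : Fin (n H) → ℕ
  position = toℕ ∘ Inverse.from L ∘ Injection.to f
  position-injective : Injective _≡_ _≡_ position
  position-injective = Injection.injective (↔⇒↣ (↔-sym L) ↣-∘ f) ∘ toℕ-injective
  sorting : Σ (Layout H) (SortedBy position)
  sorting = sortingPermutation position position-injective

¬Before-self : (G : Graph) (L : Layout G) (x : Fin (n G)) → ¬ Before G L (Inverse.from L x) x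
¬Before-self G L x (j , j<p , refl) = <-irrefl (cong toℕ (sym (Inverse.strictlyInverseʳ L j))) j<p

valueAtMost⇒supp≤ : (G : Graph) (L : Layout G) {k : ℕ} → ValueAtMost G L k →
                    ∀ x {s} → Supp G x (Before G L (Inverse.from L x)) s → s ≤ k
valueAtMost⇒supp≤ G L value x {s} supp =
  value (Inverse.from L x) s (subst (λ z → Supp G z (Before G L (Inverse.from L x)) s)
                                    (sym (Inverse.strictlyInverseˡ L x)) supp)

valueAtMost-immersion : (H G : Graph) → Immersion H G → ∀ {k} →
                        Σ (Layout G) (λ LG → ValueAtMost G LG k) →
                        Σ (Layout H) (λ LH → ValueAtMost H LH k)
valueAtMost-immersion H G im {k} (LG , LG-value) = LH , LH-value
  where
  f : Fin (n H) → Fin (n G)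
  f = Injection.to (immersionEmbedding H G im)
  LH : Layout H
  LH = proj₁ (inducedLayout {H} {G} (immersionEmbedding H G im) LG)
  LH-before : ∀ i y → Before H LH i y → Before G LG (Inverse.from LG (f (Inverse.to LH i))) (f y)
  LH-before = proj₂ (inducedLayout {H} {G} (immersionEmbedding H G im) LG)
  -- supp in G is only known to exist, and to be attained by a cut, under ¬¬; the goal is decidable.
  LH-value : ValueAtMost H LH k
  LH-value i s supp-H = decidable-stable (s ≤? k) do
    (sG , supp-G) ← ¬¬-∃supp G (¬Before-self G LG x)
    (X , (Xx≡true , XS≡false) , cut≤sG) ← ¬¬-cut≤supp G supp-G
    pure (begin
      s                  ≤⟨ supp≤cut H supp-H (Xx≡true , λ y y∈S → XS≡false _ (LH-before i y y∈S)) ⟩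
      cut (X ∘ f) (E H)  ≤⟨ cut-immersion H G im X ⟩
      cut X (E G)        ≤⟨ cut≤sG ⟩
      sG                 ≤⟨ valueAtMost⇒supp≤ G LG LG-value x supp-G ⟩
      k                  ∎)
    where
    open ≤-Reasoning
    x : Fin (n G)
    x = f (Inverse.to LH i)

mainTheorem9 : (H G : Graph) → Immersion H G →
    (dH dG : ℕ) → IsDeltaEInf H dH → IsDeltaEInf G dG → dH ≤ dG
mainTheorem9 H G im dH dG (_ , dH-minimal) (LG-value , _) =
  dH-minimal dG (valueAtMost-immersion H G im LG-value)
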